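{- Let $\mathcal{A}$ be an alignment alphabet containing the symbol $1$, let $\mathcal{B}$ be a seed alphabet as described in the context, and let $\pi=\pi_1\cdots\pi_m\in\mathcal{B}^m$ be a subset seed. Then the automaton $S_\pi$ defined in the context accepts exactly the set of all alignments $s\in\mathcal{A}^*$ matched by $\pi$.
   Context: Subset seeds: the alignment alphabet $\mathcal{A}$ is a finite alphabet containing a symbol $1$ ("match"). The seed alphabet $\mathcal{B}$ is a set of letters each denoting a subset of $\mathcal{A}$ containing $1$, and $\mathcal{B}$ contains a letter $\#$ denoting $\{1\}$. A subset seed $\pi=\pi_1\cdots\pi_m\in\mathcal{B}^m$ (span $m$) matches a word $a_1\cdots a_m\in\mathcal{A}^m$ if $a_i\in\pi_i$ for all $i$; a letter $a$ "matches" $\pi_x$ if $a\in\pi_x$. An alignment $s\in\mathcal{A}^*$ is matched by $\pi$ if $\pi$ matches some length-$m$ contiguous factor of $s$. Let $w$ be the number of positions $i$ with $\pi_i=\#$ and $R_\pi=\{i:\pi_i\neq\#\}$, $r=|R_\pi|=m-w$. Convention: $\max\emptyset=0$. The automaton $S_\pi$: its non-final states are pairs $\langle X,t\rangle$ with $X\subseteq R_\pi$, $t\in\{0,\dots,m\}$ and $\max X+t\le m-1$; there is additionally a single final state $q_F$, and any pair $\langle X,t\rangle$ with $\max X+t=m$ is identified with $q_F$. The initial state is $\langle\emptyset,0\rangle$. Transitions: $\psi(q_F,a)=q_F$ for all $a\in\mathcal{A}$; for a non-final $q=\langle X,t\rangle$: if $a=1$ then $\psi(q,a)=\langle X,t+1\rangle$;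 otherwise $\psi(q,a)=\langle X_U\cup X_V,0\rangle$ where $X_U=\{x: x\le t+1 \text{ and } a \text{ matches } \pi_x\}$ and $X_V=\{x+t+1: x\in X \text{ and } a \text{ matches } \pi_{x+t+1}\}$ (only indices $1\le x, x+t+1\le m$ are considered). -}

module Defs where

open import Data.Bool using (Bool; true; false; if_then_else_)
open import Data.Nat using (ℕ; zero; suc; _+_; _⊔_; _≡ᵇ_)
open import Data.List using (List; []; _∷_; _++_; map; filterᵇ; foldr; foldl; upTo)
open import Data.List.Membership.Propositional using (_∈_)
open import Data.List.Relation.Binary.Pointwise using (Pointwise)
open import Data.Maybe using (Maybe; just; nothing)
open import Data.Vec using (Vec; []; _∷_; toList)
open import Data.Product using (∃; ∃-syntax; _×_)
open import Data.Unit using (⊤)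
open import Data.Empty using (⊥)
open import Function.Bundles using (_⇔_)
open import Relation.Nullary using (does)
open import Relation.Binary.Definitions using (DecidableEquality)
open import Relation.Binary.PropositionalEquality using (_≡_)

-- The alignment alphabet 𝒜 (finite, decidable equality, contains the match symbol 1)
-- and the seed alphabet ℬ (letters denoting subsets of 𝒜 containing 1, including # = {1}).
record Alphabets : Set₁ where
  field
    A         : Set
    _≟A_      : DecidableEquality A
    one       : A
    enumA     : List A
    enumA-all : ∀ a → a ∈ enumA
    B         : Set
    _≟B_      : DecidableEquality B
    ⟦_⟧       : B → A → Bool            -- ⟦ b ⟧ a ≡ true  means  a ∈ b
    one∈      : ∀ b → ⟦ b ⟧ one ≡ true
    hash      : B
    hash-spec : ∀ a → (⟦ hash ⟧ a ≡ true) ⇔ (a ≡ one)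

module SubsetSeed (Σ : Alphabets) where
  open Alphabets Σ

  _∈ᴮ_ : A → B → Set
  a ∈ᴮ b = ⟦ b ⟧ a ≡ true

  SeedMatches : ∀ {m} → Vec B m → List A → Set
  SeedMatches π v = Pointwise (λ b a → a ∈ᴮ b) (toList π) v

  Matched : ∀ {m} → Vec B m → List A → Set
  Matched π s = ∃[ u ] ∃[ v ] ∃[ w ] (s ≡ u ++ v ++ w × SeedMatches π v)

  -- the letter π_x (1-based), nothing outside 1..m
  at : ∀ {m} → Vec B m → ℕ → Maybe B
  at []       _             = nothing
  at (b ∷ _)  zero          = nothing
  at (b ∷ _)  (suc zero)    = just b
  at (_ ∷ bs) (suc (suc k)) = at bs (suc k)

  matchAt : ∀ {m} → Vec B m → A → ℕ → Bool
  matchAt π a x with at π x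
  ... | just b  = ⟦ b ⟧ a
  ... | nothing = false

  maxL : List ℕ → ℕ
  maxL = foldr _⊔_ 0

  -- states of S_π : the final state q_F or a pair ⟨X , t⟩ (X a finite set of positions, as a list)
  data State : Set where
    qF  : State
    ⟨_,_⟩ : List ℕ → ℕ → State

  IsFinal : State → Set
  IsFinal qF        = ⊤
  IsFinal ⟨ _ , _ ⟩ = ⊥

  -- a pair with max X + t = m is identified with q_F
  mk : ℕ → List ℕ → ℕ → State
  mk m X t = if (maxL X + t) ≡ᵇ m then qF else ⟨ X , t ⟩

  initial : ∀ {m} → Vec B m → State
  initial {m} π = mk m [] 0

  ψ : ∀ {m} → Vec B m → State → A → State
  ψ π qF a = qF
  ψ {m} π ⟨ X , t ⟩ a with does (a ≟A one)
  ... | true  = mk m X (suc t)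
  ... | false = mk m (XU ++ XV) 0
    where
    XU = filterᵇ (matchAt π a) (map suc (upTo (suc t)))
    XV = map (λ x → x + suc t) (filterᵇ (λ x → matchAt π a (x + suc t)) X)

  run : ∀ {m} → Vec B m → State → List A → State
  run π = foldl (ψ π)

  Accepts : ∀ {m} → Vec B m → List A → Set
  Accepts π s = IsFinal (run π (initial π) s)

-- Call p a live length of a word if its last p letters match π₁ ⋯ π_p. In a
-- non-final state ⟨ X , t ⟩ reached on a word that π does not match, the live
-- lengths are exactly the p ≤ t (the last t letters are 1, which every seed letter
-- contains) and the x + t with x ∈ X, and max X + t < m. Reading 1 lengthens every
-- live length by one; reading another letter a keeps p + 1 live exactly when a
-- matches π_{p+1}, which is what X_U (from p ≤ t) and X_V (from p = x + t)
-- collect. So q_F is entered exactly when m first becomes live, i.e. when an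
-- occurrence of π ends at the current letter, and it is never left.
-- Words are recorded newest letter first, so that reading a letter is a cons;
-- an occurrence of π in s is then one of the reversed seed in the reversed word.

module Submission where

open import Defs
open import Data.Bool using (Bool; T; true; false)
open import Data.Bool.Properties using (T-≡)
open import Data.Empty using (⊥; ⊥-elim)
open import Data.List using (List; []; _∷_; _++_; [_]; _ʳ++_; map; filterᵇ; upTo; reverse)
open import Data.List.Membership.Propositional using (_∈_)
open import Data.List.Membership.Propositional.Properties
  using (∈-map⁺; ∈-map⁻; ∈-++⁺ˡ; ∈-++⁺ʳ; ∈-++⁻; ∈-filter⁺; ∈-filter⁻; ∈-upTo⁺; ∈-upTo⁻;
         foldr-selective)
open import Data.List.Properties using (reverse-++; reverse-involutive; ++-assoc; foldr-preservesᵇ)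
open import Data.List.Relation.Binary.Pointwise using (reverse⁺)
open import Data.List.Relation.Binary.Prefix.Heterogeneous using (Prefix; []; _∷_; uncons)
open import Data.List.Relation.Binary.Infix.Heterogeneous
  using (Infix; here; there; MkView; toView; fromView)
open import Data.List.Relation.Binary.Infix.Heterogeneous.Properties using (∷⁻)
import Data.List.Relation.Unary.All as All
import Data.List.Relation.Unary.Any as Any
open import Data.Maybe using (Maybe; just; nothing; maybe′)
open import Data.Nat using (ℕ; zero; suc; _+_; _≤_; _<_; _≡ᵇ_; z≤n; s≤s)
open import Data.Nat.Properties
open import Data.Product using (∃-syntax; _×_; _,_; proj₂; uncurry)
open import Data.Product.Function.NonDependent.Propositional using (_×-⇔_)
open import Data.Sum using (_⊎_; inj₁; inj₂)
open import Data.Unit using (⊤; tt)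
open import Data.Vec using (Vec; []; _∷_; _∷ʳ_; toList; initLast)
open import Data.Vec.Properties using (toList-∷ʳ)
open import Function.Base using (_∘_)
open import Function.Bundles using (_⇔_; mk⇔; module Equivalence)
open import Function.Construct.Identity using (⇔-id)
open import Function.Construct.Symmetry using (⇔-sym)
open import Function.Properties.Equivalence using (⇔-setoid)
open import Level using (0ℓ)
open import Relation.Binary.Core using (REL)
open import Relation.Binary.PropositionalEquality
  using (_≡_; _≢_; refl; sym; trans; cong; subst; subst₂; module ≡-Reasoning)
open import Relation.Nullary using (¬_; yes; no)
open import Relation.Nullary.Decidable using (T?)
import Relation.Binary.Reasoning.Setoid as SetoidReasoning

open Equivalence using (to; from)

module ⇔-Reasoning = SetoidReasoning (⇔-setoid 0ℓ)

module _ {a b r} {A : Set a} {B : Set b} {R : REL A B r} where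

  Prefix-∷⇔ : ∀ {x y xs ys} → (R x y × Prefix R xs ys) ⇔ Prefix R (x ∷ xs) (y ∷ ys)
  Prefix-∷⇔ = mk⇔ (uncurry _∷_) uncons

  Infix-reverse⁺ : ∀ {xs ys} → Infix R xs ys → Infix R (reverse xs) (reverse ys)
  Infix-reverse⁺ i with MkView pref {inf} pw suff ← toView i =
    subst (Infix R _) (sym reverse-split)
      (fromView (MkView (reverse suff) (reverse⁺ pw) (reverse pref)))
    where
    open ≡-Reasoning
    reverse-split : reverse (pref ++ inf ++ suff) ≡ reverse suff ++ reverse inf ++ reverse pref
    reverse-split = begin
      reverse (pref ++ inf ++ suff)                 ≡⟨ reverse-++ pref (inf ++ suff) ⟩
      reverse (inf ++ suff) ++ reverse pref         ≡⟨ cong (_++ reverse pref) (reverse-++ inf suff) ⟩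
      (reverse suff ++ reverse inf) ++ reverse pref ≡⟨ ++-assoc (reverse suff) _ _ ⟩
      reverse suff ++ reverse inf ++ reverse pref   ∎

  Infix-reverse⇔ : ∀ {xs ys} → Infix R xs ys ⇔ Infix R (reverse xs) (reverse ys)
  Infix-reverse⇔ {xs} {ys} = mk⇔ Infix-reverse⁺ λ i →
    subst₂ (Infix R) (reverse-involutive xs) (reverse-involutive ys) (Infix-reverse⁺ i)

module SeedAutomaton (Σ : Alphabets) where
  open Alphabets Σ
  open SubsetSeed Σ

  _∋ᴮ_ : B → A → Set
  b ∋ᴮ a = a ∈ᴮ b

  matchMaybe : A → Maybe B → Bool
  matchMaybe a = maybe′ (λ b → ⟦ b ⟧ a) false

  matchAt≡ : ∀ {m} (π : Vec B m) a x → matchAt π a x ≡ matchMaybe a (at π x)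
  matchAt≡ π a x with at π x
  ... | just b  = refl
  ... | nothing = refl

  at-∷ʳ : ∀ {n} (ys : Vec B n) y {x} → x ≤ n → at (ys ∷ʳ y) x ≡ at ys x
  at-∷ʳ []       y {zero}        z≤n       = refl
  at-∷ʳ (b ∷ ys) y {zero}        _         = refl
  at-∷ʳ (b ∷ ys) y {suc zero}    _         = refl
  at-∷ʳ (b ∷ ys) y {suc (suc x)} (s≤s x≤n) = at-∷ʳ ys y x≤n

  at-∷ʳ-last : ∀ {n} (ys : Vec B n) y → at (ys ∷ʳ y) (suc n) ≡ just y
  at-∷ʳ-last []       y = refl
  at-∷ʳ-last (b ∷ ys) y = at-∷ʳ-last ys y

  at-just : ∀ {m} (π : Vec B m) {k} → suc k ≤ m → ∃[ b ] at π (suc k) ≡ just b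
  at-just (b ∷ π) {zero}  _         = b , refl
  at-just (b ∷ π) {suc k} (s≤s k<m) = at-just π k<m

  at-just⇒≤ : ∀ {m} (π : Vec B m) {x b} → at π x ≡ just b → x ≤ m
  at-just⇒≤ []      ()
  at-just⇒≤ (c ∷ π) {zero}        ()
  at-just⇒≤ (c ∷ π) {suc zero}    _ = s≤s z≤n
  at-just⇒≤ (c ∷ π) {suc (suc x)} e = s≤s (at-just⇒≤ π e)

  matchAt-∷ʳ : ∀ {n} (ys : Vec B n) y a {x} → x ≤ n → matchAt (ys ∷ʳ y) a x ≡ matchAt ys a x
  matchAt-∷ʳ ys y a {x} x≤n = begin
    matchAt (ys ∷ʳ y) a x          ≡⟨ matchAt≡ (ys ∷ʳ y) a x ⟩
    matchMaybe a (at (ys ∷ʳ y) x)  ≡⟨ cong (matchMaybe a) (at-∷ʳ ys y x≤n) ⟩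
    matchMaybe a (at ys x)         ≡⟨ matchAt≡ ys a x ⟨
    matchAt ys a x                 ∎
    where open ≡-Reasoning

  matchAt-∷ʳ-last : ∀ {n} (ys : Vec B n) y a → matchAt (ys ∷ʳ y) a (suc n) ≡ ⟦ y ⟧ a
  matchAt-∷ʳ-last {n} ys y a =
    trans (matchAt≡ (ys ∷ʳ y) a (suc n)) (cong (matchMaybe a) (at-∷ʳ-last ys y))

  matchAt-one : ∀ {m} (π : Vec B m) {k} → suc k ≤ m → T (matchAt π one (suc k))
  matchAt-one π {k} k<m with b , e ← at-just π k<m
    rewrite matchAt≡ π one (suc k) | e = to (⇔-sym T-≡) (one∈ b)

  matchAt⇒≤ : ∀ {m} (π : Vec B m) {a x} → T (matchAt π a x) → x ≤ m
  matchAt⇒≤ π {a} {x} match with at π x in e | matchAt≡ π a x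
  ... | just b  | _        = at-just⇒≤ π e
  ... | nothing | no-match = ⊥-elim (subst T no-match match)

  -- h lists the letters read so far, the most recent one first.
  Live : ∀ {m} → Vec B m → ℕ → List A → Set
  Live π zero    h       = ⊤
  Live π (suc p) []      = ⊥
  Live π (suc p) (a ∷ h) = T (matchAt π a (suc p)) × Live π p h

  Live-∷ʳ : ∀ {n} (ys : Vec B n) y {p h} → p ≤ n → Live (ys ∷ʳ y) p h ⇔ Live ys p h
  Live-∷ʳ ys y {zero}          _   = ⇔-id _
  Live-∷ʳ ys y {suc p} {[]}    _   = ⇔-id _
  Live-∷ʳ ys y {suc p} {a ∷ h} p<n rewrite matchAt-∷ʳ ys y a p<n =
    ⇔-id _ ×-⇔ Live-∷ʳ ys y (<⇒≤ p<n)

  Live⇔Prefix : ∀ {m} (π : Vec B m) h → Live π m h ⇔ Prefix _∋ᴮ_ (reverse (toList π)) h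
  Live⇔Prefix {zero}  [] h = mk⇔ (λ _ → []) (λ _ → tt)
  Live⇔Prefix {suc n} π  h with ys , y , refl ← initLast π
    rewrite toList-∷ʳ y ys | reverse-++ (toList ys) [ y ] = last-letter h
    where
    open ⇔-Reasoning
    last-letter : ∀ h → Live (ys ∷ʳ y) (suc n) h ⇔ Prefix _∋ᴮ_ (y ∷ reverse (toList ys)) h
    last-letter []      = mk⇔ (λ ()) (λ ())
    last-letter (a ∷ h) rewrite matchAt-∷ʳ-last ys y a = begin
      (T (⟦ y ⟧ a) × Live (ys ∷ʳ y) n h)
        ≈⟨ T-≡ ×-⇔ Live-∷ʳ ys y ≤-refl ⟩
      (y ∋ᴮ a × Live ys n h)
        ≈⟨ ⇔-id _ ×-⇔ Live⇔Prefix ys h ⟩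
      (y ∋ᴮ a × Prefix _∋ᴮ_ (reverse (toList ys)) h)
        ≈⟨ Prefix-∷⇔ ⟩
      Prefix _∋ᴮ_ (y ∷ reverse (toList ys)) (a ∷ h) ∎

  Matched⇔Infix : ∀ {m} (π : Vec B m) s → Matched π s ⇔ Infix _∋ᴮ_ (toList π) s
  Matched⇔Infix π s = mk⇔ occurrence match
    where
    occurrence : ∀ {s} → Matched π s → Infix _∋ᴮ_ (toList π) s
    occurrence (u , v , w , refl , pw) = fromView (MkView u pw w)
    match : ∀ {s} → Infix _∋ᴮ_ (toList π) s → Matched π s
    match i with MkView u pw w ← toView i = u , _ , w , refl , pw

  maxL-ub : ∀ {x X} → x ∈ X → x ≤ maxL X
  maxL-ub {X = y ∷ X} (Any.here refl) = m≤m⊔n y (maxL X)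
  maxL-ub {X = y ∷ X} (Any.there x∈X) = ≤-trans (maxL-ub x∈X) (m≤n⊔m y (maxL X))

  maxL-lub : ∀ {X n} → (∀ {x} → x ∈ X → x ≤ n) → maxL X ≤ n
  maxL-lub bound = foldr-preservesᵇ ⊔-lub z≤n (All.tabulate bound)

  Tracked : List ℕ → ℕ → ℕ → Set
  Tracked X t p = p ≤ t ⊎ ∃[ x ] x ∈ X × x + t ≡ p

  Tracked-≤ : ∀ {X t p} → Tracked X t p → p ≤ maxL X + t
  Tracked-≤ {X} {t} (inj₁ p≤t)               = ≤-trans p≤t (m≤n+m t (maxL X))
  Tracked-≤ {X} {t} (inj₂ (x , x∈X , refl)) = +-monoˡ-≤ t (maxL-ub x∈X)

  Tracked-max : ∀ X t → Tracked X t (maxL X + t)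
  Tracked-max X t with foldr-selective ⊔-sel 0 X
  ... | inj₁ max≡0   = inj₁ (≤-reflexive (cong (_+ t) max≡0))
  ... | inj₂ max∈X   = inj₂ (maxL X , max∈X , refl)

  Tracked-suc : ∀ {X t k} → Tracked X (suc t) (suc k) ⇔ Tracked X t k
  Tracked-suc {X} {t} = mk⇔ pred′ suc′
    where
    pred′ : ∀ {k} → Tracked X (suc t) (suc k) → Tracked X t k
    pred′ (inj₁ (s≤s k≤t))      = inj₁ k≤t
    pred′ (inj₂ (x , x∈X , e)) = inj₂ (x , x∈X , suc-injective (trans (sym (+-suc x t)) e))
    suc′ : ∀ {k} → Tracked X t k → Tracked X (suc t) (suc k)
    suc′ (inj₁ k≤t)            = inj₁ (s≤s k≤t)
    suc′ (inj₂ (x , x∈X , e)) = inj₂ (x , x∈X , trans (+-suc x t) (cong suc e))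

  Tracked-0⇔∈ : ∀ {X k} → Tracked X 0 (suc k) ⇔ suc k ∈ X
  Tracked-0⇔∈ {X} {k} = mk⇔ member (λ k∈X → inj₂ (suc k , k∈X , +-identityʳ (suc k)))
    where
    member : Tracked X 0 (suc k) → suc k ∈ X
    member (inj₂ (x , x∈X , e)) = subst (_∈ X) (trans (sym (+-identityʳ x)) e) x∈X

  module Run {m} (π : Vec B m) where

    Occurred : List A → Set
    Occurred = Infix _∋ᴮ_ (reverse (toList π))

    TracksLive : List ℕ → ℕ → List A → Set
    TracksLive X t h = ∀ k → Live π (suc k) h ⇔ Tracked X t (suc k)

    Describes : State → List A → Set
    Describes qF        h = Occurred h
    Describes ⟨ X , t ⟩ h = ¬ Occurred h × maxL X + t < m × TracksLive X t h

    Occurred-[] : Occurred [] ⇔ Live π m []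
    Occurred-[] = mk⇔ (λ { (here pre) → from (Live⇔Prefix π []) pre })
                      (here ∘ to (Live⇔Prefix π []))

    Occurred-∷ : ∀ {a h} → ¬ Occurred h → Occurred (a ∷ h) ⇔ Live π m (a ∷ h)
    Occurred-∷ {a} {h} never = mk⇔ now (here ∘ to (Live⇔Prefix π (a ∷ h)))
      where
      now : Occurred (a ∷ h) → Live π m (a ∷ h)
      now o with ∷⁻ o
      ... | inj₁ pre     = from (Live⇔Prefix π (a ∷ h)) pre
      ... | inj₂ earlier = ⊥-elim (never earlier)

    Live⇔Tracked : ∀ {X t h} → TracksLive X t h →
                   ∀ p → Live π p h ⇔ Tracked X t p
    Live⇔Tracked live zero    = mk⇔ (λ _ → inj₁ z≤n) (λ _ → tt)
    Live⇔Tracked live (suc k) = live k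

    mk-describes : ∀ X t {h} → (Occurred h ⇔ Live π m h) → maxL X + t ≤ m →
                   TracksLive X t h → Describes (mk m X t) h
    mk-describes X t {h} occurred bound live with maxL X + t ≡ᵇ m in eq
    ... | true  = from occurred (from (Live⇔Tracked live m) m-tracked)
      where
      reaches-m : maxL X + t ≡ m
      reaches-m = ≡ᵇ⇒≡ _ _ (subst T (sym eq) tt)
      m-tracked : Tracked X t m
      m-tracked = subst (Tracked X t) reaches-m (Tracked-max X t)
    ... | false = never , ≤∧≢⇒< bound short-of-m , live
      where
      short-of-m : maxL X + t ≢ m
      short-of-m e = subst T eq (≡⇒≡ᵇ _ _ e)
      never : ¬ Occurred h
      never o = short-of-m (≤-antisym bound (Tracked-≤ (to (Live⇔Tracked live m) (to occurred o))))

    match-step : ∀ X t {h} → ¬ Occurred h → suc (maxL X + t) ≤ m →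
                 TracksLive X t h → Describes (mk m X (suc t)) (one ∷ h)
    match-step X t {h} never bound live = mk-describes X (suc t) (Occurred-∷ never) bound′ live′
      where
      bound′ : maxL X + suc t ≤ m
      bound′ = subst (_≤ m) (sym (+-suc (maxL X) t)) bound
      live′ : ∀ k → Live π (suc k) (one ∷ h) ⇔ Tracked X (suc t) (suc k)
      live′ k = mk⇔
        (λ (_ , live-k) → from Tracked-suc (to (Live⇔Tracked live k) live-k))
        (λ tracked → matchAt-one π (≤-trans (Tracked-≤ tracked) bound′) ,
                     from (Live⇔Tracked live k) (to Tracked-suc tracked))

    XU : A → ℕ → List ℕ
    XU a t = filterᵇ (matchAt π a) (map suc (upTo (suc t)))

    XV : A → List ℕ → ℕ → List ℕ
    XV a X t = map (_+ suc t) (filterᵇ (λ x → matchAt π a (x + suc t)) X)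

    liveAfter : A → List ℕ → ℕ → List ℕ
    liveAfter a X t = XU a t ++ XV a X t

    liveAfter-≤ : ∀ a X t {y} → y ∈ liveAfter a X t → y ≤ m
    liveAfter-≤ a X t y∈ with ∈-++⁻ (XU a t) y∈
    ... | inj₁ y∈U = matchAt⇒≤ π (proj₂ (∈-filter⁻ (T? ∘ matchAt π a) y∈U))
    ... | inj₂ y∈V with x , x∈ , refl ← ∈-map⁻ (_+ suc t) y∈V =
      matchAt⇒≤ π (proj₂ (∈-filter⁻ (T? ∘ matchAt π a ∘ (_+ suc t)) {xs = X} x∈))

    ∈-liveAfter : ∀ a X t {k} →
                  suc k ∈ liveAfter a X t ⇔ (T (matchAt π a (suc k)) × Tracked X t k)
    ∈-liveAfter a X t = mk⇔ survives extends
      where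
      survives : ∀ {k} → suc k ∈ liveAfter a X t → T (matchAt π a (suc k)) × Tracked X t k
      survives k∈ with ∈-++⁻ (XU a t) k∈
      ... | inj₁ k∈U with k∈ , match ← ∈-filter⁻ (T? ∘ matchAt π a) k∈U
                     with _ , k<t+1 , refl ← ∈-map⁻ suc k∈ =
        match , inj₁ (≤-pred (∈-upTo⁻ k<t+1))
      ... | inj₂ k∈V with x , x∈ , e ← ∈-map⁻ (_+ suc t) k∈V
                     with x∈X , match ← ∈-filter⁻ (T? ∘ matchAt π a ∘ (_+ suc t)) x∈ =
        subst (T ∘ matchAt π a) (sym e) match ,
        inj₂ (x , x∈X , suc-injective (trans (sym (+-suc x t)) (sym e)))
      extends : ∀ {k} → T (matchAt π a (suc k)) × Tracked X t k → suc k ∈ liveAfter a X t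
      extends (match , inj₁ k≤t) =
        ∈-++⁺ˡ (∈-filter⁺ (T? ∘ matchAt π a) (∈-map⁺ suc (∈-upTo⁺ (s≤s k≤t))) match)
      extends (match , inj₂ (x , x∈X , refl)) = subst (_∈ liveAfter a X t) (+-suc x t)
        (∈-++⁺ʳ (XU a t) (∈-map⁺ (_+ suc t) (∈-filter⁺ (T? ∘ matchAt π a ∘ (_+ suc t)) x∈X match′)))
        where
        match′ : T (matchAt π a (x + suc t))
        match′ = subst (T ∘ matchAt π a) (sym (+-suc x t)) match

    mismatch-step : ∀ a X t {h} → ¬ Occurred h → TracksLive X t h →
                    Describes (mk m (liveAfter a X t) 0) (a ∷ h)
    mismatch-step a X t {h} never live =
      mk-describes (liveAfter a X t) 0 (Occurred-∷ never) bound live′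
      where
      open ⇔-Reasoning
      bound : maxL (liveAfter a X t) + 0 ≤ m
      bound = subst (_≤ m) (sym (+-identityʳ _)) (maxL-lub (liveAfter-≤ a X t))
      live′ : ∀ k → Live π (suc k) (a ∷ h) ⇔ Tracked (liveAfter a X t) 0 (suc k)
      live′ k = begin
        (T (matchAt π a (suc k)) × Live π k h)    ≈⟨ ⇔-id _ ×-⇔ Live⇔Tracked live k ⟩
        (T (matchAt π a (suc k)) × Tracked X t k) ≈⟨ ∈-liveAfter a X t ⟨
        suc k ∈ liveAfter a X t                   ≈⟨ Tracked-0⇔∈ ⟨
        Tracked (liveAfter a X t) 0 (suc k)       ∎

    step-describes : ∀ q a {h} → Describes q h → Describes (ψ π q a) (a ∷ h)
    step-describes qF        a occurred                = there occurred
    step-describes ⟨ X , t ⟩ a (never , bound , live) with a ≟A one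
    ... | yes refl = match-step X t never bound live
    ... | no _     = mismatch-step a X t never live

    run-describes : ∀ q s {h} → Describes q h → Describes (run π q s) (s ʳ++ h)
    run-describes q []      d = d
    run-describes q (a ∷ s) d = run-describes (ψ π q a) s (step-describes q a d)

    initial-describes : Describes (initial π) []
    initial-describes = mk-describes [] 0 Occurred-[] z≤n λ _ → mk⇔ (λ ()) λ where
      (inj₁ ())
      (inj₂ (_ , () , _))

    final⇔Occurred : ∀ q {h} → Describes q h → IsFinal q ⇔ Occurred h
    final⇔Occurred qF        occurred    = mk⇔ (λ _ → occurred) (λ _ → tt)
    final⇔Occurred ⟨ X , t ⟩ (never , _) = mk⇔ (λ ()) never

    Accepts⇔Occurred : ∀ s → Accepts π s ⇔ Occurred (reverse s)
    Accepts⇔Occurred s =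
      final⇔Occurred (run π (initial π) s) (run-describes (initial π) s initial-describes)

lemma3 : (Σ : Alphabets) → ∀ {m} (π : Vec (Alphabets.B Σ) m) (s : List (Alphabets.A Σ)) →
    SubsetSeed.Accepts Σ π s ⇔ SubsetSeed.Matched Σ π s
lemma3 Σ π s = begin
  Accepts π s                                 ≈⟨ Accepts⇔Occurred s ⟩
  Infix _∋ᴮ_ (reverse (toList π)) (reverse s) ≈⟨ Infix-reverse⇔ ⟨
  Infix _∋ᴮ_ (toList π) s                     ≈⟨ Matched⇔Infix π s ⟨
  Matched π s                                 ∎
  where
  open SubsetSeed Σ
  open SeedAutomaton Σ
  open Run π
  open ⇔-Reasoning
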